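{- Let $T$ be a labeled alternative tableau and $k\in Free(T)$. Then the tableau $T[k]$ is a packed tableau, and $k$ labels its only free row or free column.
   Context: A shape of length $n$ is a Ferrers diagram in English notation, possibly with empty rows or columns. It is determined by its south-east border, a path of $n$ unit south/west steps from the top-right corner to the bottom-left corner. South steps correspond to rows and west steps to columns. The shape is labeled by a set of integers $L=\{i_1<\dots<i_n\}$ if $i_1,\dots,i_n$ are attached to the rows and columns in the order in which their steps occur along the south-east border from top-right to bottom-left. Hence a cell in row $i$ and column $j$ exists iff $i<j$; it is denoted $(i,j)$. An alternative tableau is a shape with a partial filling of cells by left arrows and up arrows such that every cell to the left of a left arrow in its row, and every cell above an up arrow in its column, is empty. A free row is a row with no left arrow; a free column is a column with no up arrow. $Free(T)$ is the set of labels of free rows and free columns. For $k\in Free(T)$, $T(k)$ is the smallest $X\subseteq L$ with $k\in X$ such that, for every cell $(i,j)$ containing an arrow, $i\in X$ iff $j\in X$. For $A\subseteq L$, $T[A]$ is the labeled tableau with label set $A$ in which $l\in A$ labels a row (resp. column) iff it labels a row (resp. column) of $T$, and each cell $(i,j)$ has the same filling as cell $(i,j)$ of $T$. We write $T[k]:=T[T(k)]$. A packed tableau is an alternative tableau of length $n>0$ having either no free row and exactly one free column, or exactly one free row and no free column. -}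

module Defs where

open import Data.Bool using (Bool; true; false)
open import Data.Integer using (ℤ; _<_; _≟_)
open import Data.List using (List; length)
open import Data.List.Relation.Unary.Linked using (Linked)
open import Data.List.Membership.DecPropositional _≟_ using (_∈_; _∈?_)
open import Data.Nat using () renaming (_<_ to _<ℕ_)
open import Data.Product using (Σ; _×_; _,_)
open import Data.Sum using (_⊎_; inj₁; inj₂)
open import Data.Empty using (⊥; ⊥-elim)
open import Relation.Nullary using (¬_; yes; no)
open import Relation.Binary.PropositionalEquality using (_≡_; refl; sym; trans)

data Arrow : Set where
  empty left up : Arrow

IsArrow : Arrow → Set
IsArrow a = (a ≡ left) ⊎ (a ≡ up)

-- A labeled alternative tableau.
--  * labels   : the label set L, listed in increasing order (= order along
--               the south-east border from top-right to bottom-left);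
--  * isRow l  : true iff label l is a row (south step), false iff a column;
--  * fill i j : filling of cell (i,j).  Rows with larger labels are lower; columns with
-- larger labels are further to the left.
record Tableau : Set where
  field
    labels  : List ℤ
    sorted  : Linked _<_ labels
    isRow   : ℤ → Bool
    fill    : ℤ → ℤ → Arrow
    wf      : ∀ i j → IsArrow (fill i j) →
              (i ∈ labels) × (j ∈ labels) × (isRow i ≡ true) × (isRow j ≡ false) × (i < j)
    leftEmpty : ∀ i j j' → fill i j ≡ left → j < j' → fill i j' ≡ empty
    upEmpty   : ∀ i j i' → fill i j ≡ up → i' < i → fill i' j ≡ empty

open Tableau public

FreeRow : Tableau → ℤ → Set
FreeRow T i = (i ∈ labels T) × (isRow T i ≡ true) × (∀ j → ¬ (fill T i j ≡ left))

FreeCol : Tableau → ℤ → Set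
FreeCol T j = (j ∈ labels T) × (isRow T j ≡ false) × (∀ i → ¬ (fill T i j ≡ up))

Free : Tableau → ℤ → Set
Free T k = FreeRow T k ⊎ FreeCol T k

-- T(k): the smallest set X of labels containing k such that for every cell
-- (i,j) containing an arrow, i ∈ X iff j ∈ X  (inductively generated).
data Conn (T : Tableau) (k : ℤ) : ℤ → Set where
  base : Conn T k k
  fwd  : ∀ {i j} → Conn T k i → IsArrow (fill T i j) → Conn T k j
  bwd  : ∀ {i j} → Conn T k j → IsArrow (fill T i j) → Conn T k i

-- T[A]: label set A, same row/column status, same fillings on cells (i,j)
-- with i, j ∈ A.
restrictFill : Tableau → List ℤ → ℤ → ℤ → Arrow
restrictFill T A i j with i ∈? A | j ∈? A
... | yes _ | yes _ = fill T i j
... | _     | _     = empty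

private
  rwf : ∀ T A i j → IsArrow (restrictFill T A i j) →
        (i ∈ A) × (j ∈ A) × (isRow T i ≡ true) × (isRow T j ≡ false) × (i < j)
  rwf T A i j p with i ∈? A | j ∈? A
  rwf T A i j p | yes a | yes b with wf T i j p
  ... | _ , _ , r , c , lt = a , b , r , c , lt
  rwf T A i j (inj₁ ()) | yes _ | no _
  rwf T A i j (inj₂ ()) | yes _ | no _
  rwf T A i j (inj₁ ()) | no _ | _
  rwf T A i j (inj₂ ()) | no _ | _

  rcases : ∀ T A i j → (restrictFill T A i j ≡ fill T i j) ⊎ (restrictFill T A i j ≡ empty)
  rcases T A i j with i ∈? A | j ∈? A
  ... | yes _ | yes _ = inj₁ refl
  ... | yes _ | no _  = inj₂ refl
  ... | no _  | _     = inj₂ refl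

  rback : ∀ T A i j a → restrictFill T A i j ≡ a → ¬ (a ≡ empty) → fill T i j ≡ a
  rback T A i j a p ne with rcases T A i j
  ... | inj₁ q = trans (sym q) p
  ... | inj₂ q = ⊥-elim (ne (trans (sym p) q))

  rempty : ∀ T A i j → fill T i j ≡ empty → restrictFill T A i j ≡ empty
  rempty T A i j e with rcases T A i j
  ... | inj₁ q = trans q e
  ... | inj₂ q = q

  rleft : ∀ T A i j j' → restrictFill T A i j ≡ left → j < j' → restrictFill T A i j' ≡ empty
  rleft T A i j j' p lt = rempty T A i j' (leftEmpty T i j j' (rback T A i j left p (λ ())) lt)

  rup : ∀ T A i j i' → restrictFill T A i j ≡ up → i' < i → restrictFill T A i' j ≡ empty
  rup T A i j i' p lt = rempty T A i' j (upEmpty T i j i' (rback T A i j up p (λ ())) lt)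

restrict : (T : Tableau) (A : List ℤ) → Linked _<_ A → Tableau
restrict T A s = record
  { labels = A ; sorted = s ; isRow = isRow T ; fill = restrictFill T A
  ; wf = rwf T A ; leftEmpty = rleft T A ; upEmpty = rup T A }

ExactlyOne : (ℤ → Set) → Set
ExactlyOne P = Σ ℤ λ x → P x × (∀ y → P y → y ≡ x)

NoneOf : (ℤ → Set) → Set
NoneOf P = ∀ x → ¬ P x

Packed : Tableau → Set
Packed T = (0 <ℕ length (labels T)) ×
           ((NoneOf (FreeRow T) × ExactlyOne (FreeCol T)) ⊎
            (ExactlyOne (FreeRow T) × NoneOf (FreeCol T)))

module Submission where

-- In an alternative tableau every label has at most one
-- "parent": a row points to the column of its left arrow, a column points
-- to the row of its up arrow.  Write  y ⟶ z  when z is the parent of y.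
-- Then  ⟶  is deterministic (a row has at most one left arrow, a column at
-- most one up arrow), the labels without parent are exactly the free rows
-- and columns, and  ⟶  is well founded (going row → column → row strictly
-- decreases the row label).  Hence every label y has a unique free "root",
-- reached by following parents.  Every arrow is a parent edge in one
-- direction, so roots are constant on the connected set T(k); for a free
-- k this set is exactly the set of labels whose root is k.  Consequently
-- k is the only free label connected to k, and T(k) is decidable.
-- Finally, restricting T to the arrow-closed set T(k) neither creates nor
-- destroys free rows or columns, so k is the unique free label of T[k],
-- which makes T[k] packed.

open import Defs
open import Data.Integer using (ℤ; _<_; _≟_)
open import Data.List using (List)
open import Data.List.Relation.Unary.Linked using (Linked)
open import Data.List.Membership.DecPropositional _≟_ using (_∈_)
open import Data.Product using (Σ; _×_)
open import Function.Bundles using (_⇔_)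

open import Data.Bool using (Bool; true; false)
open import Data.Empty using (⊥; ⊥-elim)
open import Data.Integer using (_≤_; _-_; +_; ∣_∣; -_)
import Data.Integer.Properties as ℤ
open import Data.List using ([]; _∷_; length; filter)
open import Data.List.Extrema ℤ.≤-totalOrder using (min; min≤xs)
open import Data.List.Membership.DecPropositional _≟_ using (_∈?_; lose)
open import Data.List.Membership.Propositional.Properties using (∈-filter⁺; ∈-filter⁻)
open import Data.List.Relation.Binary.Subset.Propositional using (_⊆_)
open import Data.List.Relation.Binary.Subset.Propositional.Properties using (filter-⊆)
import Data.List.Relation.Unary.All as All
open import Data.List.Relation.Unary.Any using (any?; satisfied)
import Data.List.Relation.Unary.Linked.Properties as Linked
open import Data.Nat using (ℕ; zero; suc; s≤s; z≤n) renaming (_<_ to _<ℕ_)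
import Data.Nat.Properties as ℕ
open import Data.Product using (_,_; proj₁; proj₂; ∃)
open import Data.Sum using (_⊎_; inj₁; inj₂; swap)
open import Function using (_∘_)
open import Function.Bundles using (mk⇔; Equivalence)
open import Level using (Level; _⊔_; 0ℓ)
open import Relation.Binary.Core using (Rel)
open import Relation.Binary.Construct.Closure.ReflexiveTransitive using (Star; ε; _◅_)
open import Relation.Binary.Definitions using (tri<; tri≈; tri>)
open import Relation.Binary.PropositionalEquality using (_≡_; _≢_; refl; sym; trans; subst)
open import Relation.Nullary using (¬_; yes; no; Dec)

open Equivalence using (to; from)

notBoth : ∀ {b : Bool} → b ≡ true → b ≡ false → ⊥
notBoth refl ()

module Deterministic {a ℓ : Level} {X : Set a} (_⟶_ : Rel X ℓ)
  (det : ∀ {x y z} → x ⟶ y → x ⟶ z → y ≡ z) where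

  Terminal : X → Set (a ⊔ ℓ)
  Terminal x = ∀ {y} → ¬ (x ⟶ y)

  terminal-path : ∀ {x y} → Terminal x → Star _⟶_ x y → x ≡ y
  terminal-path t ε       = refl
  terminal-path t (s ◅ _) = ⊥-elim (t s)

  normalForm-unique : ∀ {x r r'} → Star _⟶_ x r → Terminal r →
                      Star _⟶_ x r' → Terminal r' → r ≡ r'
  normalForm-unique ε        t q        t' = terminal-path t q
  normalForm-unique (s ◅ p)  t ε        t' = ⊥-elim (t' s)
  normalForm-unique (s ◅ p)  t (s' ◅ q) t' with det s s'
  ... | refl = normalForm-unique p t q t'

distance-mono : ∀ {b i' i} → b ≤ i' → i' < i → ∣ i' - b ∣ <ℕ ∣ i - b ∣
distance-mono {b} {i'} {i} b≤i' i'<i = ℤ.drop‿+<+ lifted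
  where
  b≤i : b ≤ i
  b≤i = ℤ.<⇒≤ (ℤ.≤-<-trans b≤i' i'<i)
  lifted : + ∣ i' - b ∣ < + ∣ i - b ∣
  lifted rewrite ℤ.0≤i⇒+∣i∣≡i (ℤ.i≤j⇒0≤j-i b≤i') | ℤ.0≤i⇒+∣i∣≡i (ℤ.i≤j⇒0≤j-i b≤i)
    = ℤ.+-monoˡ-< (- b) i'<i

_≟A_ : (a b : Arrow) → Dec (a ≡ b)
empty ≟A empty = yes refl
empty ≟A left  = no (λ ())
empty ≟A up    = no (λ ())
left  ≟A empty = no (λ ())
left  ≟A left  = yes refl
left  ≟A up    = no (λ ())
up    ≟A empty = no (λ ())
up    ≟A left  = no (λ ())
up    ≟A up    = yes refl

module _ (T : Tableau) where

  arrowRow : ∀ {i j} → IsArrow (fill T i j) → isRow T i ≡ true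
  arrowRow a = proj₁ (proj₂ (proj₂ (wf T _ _ a)))

  arrowCol : ∀ {i j} → IsArrow (fill T i j) → isRow T j ≡ false
  arrowCol a = proj₁ (proj₂ (proj₂ (proj₂ (wf T _ _ a))))

  arrowMemRow : ∀ {i j} → IsArrow (fill T i j) → i ∈ labels T
  arrowMemRow a = proj₁ (wf T _ _ a)

  arrowMemCol : ∀ {i j} → IsArrow (fill T i j) → j ∈ labels T
  arrowMemCol a = proj₁ (proj₂ (wf T _ _ a))

  freeMem : ∀ {k} → Free T k → k ∈ labels T
  freeMem (inj₁ (m , _)) = m
  freeMem (inj₂ (m , _)) = m

  leftUnique : ∀ {i j j'} → fill T i j ≡ left → fill T i j' ≡ left → j ≡ j'
  leftUnique {i} {j} {j'} e e' with ℤ.<-cmp j j'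
  ... | tri< j<j' _ _ with trans (sym e') (leftEmpty T i j j' e j<j')
  ...   | ()
  leftUnique e e' | tri≈ _ j≡j' _ = j≡j'
  leftUnique {i} {j} {j'} e e' | tri> _ _ j'<j with trans (sym e) (leftEmpty T i j' j e' j'<j)
  ...   | ()

  upUnique : ∀ {i i' j} → fill T i j ≡ up → fill T i' j ≡ up → i ≡ i'
  upUnique {i} {i'} {j} e e' with ℤ.<-cmp i i'
  ... | tri< i<i' _ _ with trans (sym e) (upEmpty T i' j i e' i<i')
  ...   | ()
  upUnique e e' | tri≈ _ i≡i' _ = i≡i'
  upUnique {i} {i'} {j} e e' | tri> _ _ i'<i with trans (sym e') (upEmpty T i j i' e i'<i)
  ...   | ()

  leftThenUp : ∀ {i i' j} → fill T i j ≡ left → fill T i' j ≡ up → i' < i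
  leftThenUp {i} {i'} {j} e e' with ℤ.<-cmp i' i
  ... | tri< i'<i _ _ = i'<i
  ... | tri≈ _ refl _ with trans (sym e) e'
  ...   | ()
  leftThenUp {i} {i'} {j} e e' | tri> _ _ i<i' with trans (sym e) (upEmpty T i' j i e' i<i')
  ...   | ()

  Step : Rel ℤ 0ℓ
  Step y z = (fill T y z ≡ left) ⊎ (fill T z y ≡ up)

  stepDeterministic : ∀ {y z z'} → Step y z → Step y z' → z ≡ z'
  stepDeterministic (inj₁ e) (inj₁ e') = leftUnique e e'
  stepDeterministic (inj₂ e) (inj₂ e') = upUnique e e'
  stepDeterministic (inj₁ e) (inj₂ e') = ⊥-elim (notBoth (arrowRow (inj₁ e)) (arrowCol (inj₂ e')))
  stepDeterministic (inj₂ e) (inj₁ e') = ⊥-elim (notBoth (arrowRow (inj₁ e')) (arrowCol (inj₂ e)))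

  open Deterministic Step stepDeterministic

  freeTerminal : ∀ {y} → Free T y → Terminal y
  freeTerminal (inj₁ (_ , _ , noLeft)) (inj₁ e) = noLeft _ e
  freeTerminal (inj₁ (_ , r , _))      (inj₂ e) = notBoth r (arrowCol (inj₂ e))
  freeTerminal (inj₂ (_ , c , _))      (inj₁ e) = notBoth (arrowRow (inj₁ e)) c
  freeTerminal (inj₂ (_ , _ , noUp))   (inj₂ e) = noUp _ e

  arrowStep : ∀ {i j} → IsArrow (fill T i j) → Step i j ⊎ Step j i
  arrowStep (inj₁ e) = inj₁ (inj₁ e)
  arrowStep (inj₂ e) = inj₂ (inj₂ e)

  -- Whether a row has a left arrow (a column an up arrow) is decidable,
  -- since arrows only sit in cells indexed by labels.
  leftOf : ∀ i → (∃ λ j → fill T i j ≡ left) ⊎ (∀ j → ¬ (fill T i j ≡ left))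
  leftOf i with any? (λ j → fill T i j ≟A left) (labels T)
  ... | yes found = inj₁ (satisfied found)
  ... | no none   = inj₂ (λ j e → none (lose (arrowMemCol (inj₁ e)) e))

  upOf : ∀ j → (∃ λ i → fill T i j ≡ up) ⊎ (∀ i → ¬ (fill T i j ≡ up))
  upOf j with any? (λ i → fill T i j ≟A up) (labels T)
  ... | yes found = inj₁ (satisfied found)
  ... | no none   = inj₂ (λ i e → none (lose (arrowMemRow (inj₂ e)) e))

  Root : ℤ → ℤ → Set
  Root y r = Star Step y r × Free T r

  rootUnique : ∀ {y r r'} → Root y r → Root y r' → r ≡ r'
  rootUnique (p , fr) (q , fr') = normalForm-unique p (freeTerminal fr) q (freeTerminal fr')

  extend : ∀ {y z r} → Step y z → Root z r → Root y r
  extend s (p , fr) = s ◅ p , fr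

  colRoot : ∀ j → j ∈ labels T → isRow T j ≡ false →
            (∀ {i} → fill T i j ≡ up → ∃ (Root i)) → ∃ (Root j)
  colRoot j m c upperRoot with upOf j
  ... | inj₂ noUp = j , ε , inj₂ (m , c , noUp)
  ... | inj₁ (i , e) with upperRoot e
  ...   | r , R = r , extend (inj₂ e) R

  lowest : ℤ
  lowest = min (+ 0) (labels T)

  lowest≤ : ∀ {x} → x ∈ labels T → lowest ≤ x
  lowest≤ = All.lookup (min≤xs (+ 0) (labels T))

  -- Distance from the lowest label; it decreases from a row to the row
  -- reached two parent steps later.
  height : ℤ → ℕ
  height x = ∣ x - lowest ∣

  rowRoot : (n : ℕ) → ∀ i → i ∈ labels T → isRow T i ≡ true → height i <ℕ n → ∃ (Root i)
  rowRoot zero    i m r ()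
  rowRoot (suc n) i m r i<n with leftOf i
  ... | inj₂ noLeft = i , ε , inj₁ (m , r , noLeft)
  ... | inj₁ (j , e) with colRoot j (arrowMemCol (inj₁ e)) (arrowCol (inj₁ e)) above
    where
    above : ∀ {i'} → fill T i' j ≡ up → ∃ (Root i')
    above {i'} e' = rowRoot n i' (arrowMemRow (inj₂ e')) (arrowRow (inj₂ e'))
      (ℕ.<-≤-trans (distance-mono (lowest≤ (arrowMemRow (inj₂ e'))) (leftThenUp e e'))
                   (ℕ.≤-pred i<n))
  ...   | r , R = r , extend (inj₁ e) R

  root : ∀ y → y ∈ labels T → ∃ (Root y)
  root y m with isRow T y in isRowY
  ... | true  = rowRoot (suc (height y)) y m isRowY (ℕ.n<1+n _)
  ... | false = colRoot y m isRowY
                  (λ e → rowRoot _ _ (arrowMemRow (inj₂ e)) (arrowRow (inj₂ e)) (ℕ.n<1+n _))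

  rootAcross : ∀ {y z r} → Step y z ⊎ Step z y → z ∈ labels T → Root y r → Root z r
  rootAcross (inj₂ s) _ R = extend s R
  rootAcross {z = z} (inj₁ s) m R with root z m
  ... | r' , R' with rootUnique R (extend s R')
  ...   | refl = R'

  connRoot : ∀ {k x r} → Conn T k x → Root k r → Root x r
  connRoot base     R = R
  connRoot (fwd c a) R = rootAcross (arrowStep a) (arrowMemCol a) (connRoot c R)
  connRoot (bwd c a) R = rootAcross (swap (arrowStep a)) (arrowMemRow a) (connRoot c R)

  pathConn : ∀ {k x} → Star Step x k → Conn T k x
  pathConn ε            = base
  pathConn (inj₁ e ◅ p) = bwd (pathConn p) (inj₁ e)
  pathConn (inj₂ e ◅ p) = fwd (pathConn p) (inj₂ e)

  componentOfFree : ∀ {k x} → Free T k → Conn T k x ⇔ Star Step x k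
  componentOfFree fk = mk⇔ (λ c → proj₁ (connRoot c (ε , fk))) pathConn

  freeUnique : ∀ {k x} → Free T k → Free T x → Conn T k x → x ≡ k
  freeUnique fk fx c = terminal-path (freeTerminal fx) (to (componentOfFree fk) c)

  connMem : ∀ {k x} → k ∈ labels T → Conn T k x → x ∈ labels T
  connMem m base      = m
  connMem m (fwd _ a) = arrowMemCol a
  connMem m (bwd _ a) = arrowMemRow a

  -- Membership in T(k) is decidable: compare the root of x with k.
  connDec : ∀ {k} → Free T k → ∀ x → Dec (Conn T k x)
  connDec {k} fk x with x ∈? labels T
  ... | no  x∉ = no (x∉ ∘ connMem (freeMem fk))
  ... | yes x∈ with root x x∈
  ...   | r , p , fr with r ≟ k
  ...     | yes refl = yes (pathConn p)
  ...     | no  r≢k  = no (λ c → r≢k (rootUnique (p , fr) (to (componentOfFree fk) c , fk)))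

ArrowClosed : Tableau → List ℤ → Set
ArrowClosed T A = ∀ {i j} → IsArrow (fill T i j) → (i ∈ A → j ∈ A) × (j ∈ A → i ∈ A)

componentClosed : ∀ T {k} A → (∀ x → (x ∈ A) ⇔ Conn T k x) → ArrowClosed T A
componentClosed T A inA a =
  (λ i∈ → from (inA _) (fwd (to (inA _) i∈) a)) ,
  (λ j∈ → from (inA _) (bwd (to (inA _) j∈) a))

restrictInside : ∀ T A {i j} → i ∈ A → j ∈ A → restrictFill T A i j ≡ fill T i j
restrictInside T A {i} {j} i∈ j∈ with i ∈? A | j ∈? A
... | yes _ | yes _ = refl
... | no i∉ | _     = ⊥-elim (i∉ i∈)
... | yes _ | no j∉ = ⊥-elim (j∉ j∈)

restrictArrow : ∀ T A {i j a} → a ≢ empty → restrictFill T A i j ≡ a → fill T i j ≡ a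
restrictArrow T A {i} {j} a≢empty e with i ∈? A | j ∈? A
... | yes _ | yes _ = e
... | yes _ | no _  = ⊥-elim (a≢empty (sym e))
... | no _  | _     = ⊥-elim (a≢empty (sym e))

restrictFree⁺ : ∀ T A s {x} → Free T x → x ∈ A → Free (restrict T A s) x
restrictFree⁺ T A s (inj₁ (_ , r , noLeft)) x∈ =
  inj₁ (x∈ , r , λ j e → noLeft j (restrictArrow T A (λ ()) e))
restrictFree⁺ T A s (inj₂ (_ , c , noUp))   x∈ =
  inj₂ (x∈ , c , λ i e → noUp i (restrictArrow T A (λ ()) e))

restrictFree⁻ : ∀ T A s {x} → A ⊆ labels T → ArrowClosed T A →
                Free (restrict T A s) x → Free T x
restrictFree⁻ T A s A⊆L closed (inj₁ (x∈ , r , noLeft)) =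
  inj₁ (A⊆L x∈ , r , λ j e →
    noLeft j (trans (restrictInside T A x∈ (proj₁ (closed (inj₁ e)) x∈)) e))
restrictFree⁻ T A s A⊆L closed (inj₂ (x∈ , c , noUp)) =
  inj₂ (A⊆L x∈ , c , λ i e →
    noUp i (trans (restrictInside T A (proj₂ (closed (inj₂ e)) x∈) x∈) e))

nonempty : ∀ {k} {xs : List ℤ} → k ∈ xs → 0 <ℕ length xs
nonempty {xs = _ ∷ _} _ = s≤s z≤n

packedOfUniqueFree : ∀ R {k} → Free R k → (∀ x → Free R x → x ≡ k) → Packed R
packedOfUniqueFree R (inj₁ fr@(k∈ , r , _)) only =
  nonempty k∈ ,
  inj₂ ((_ , fr , λ y fy → only y (inj₁ fy)) ,
        λ y fy → notBoth r (subst (λ z → isRow R z ≡ false) (only y (inj₂ fy)) (proj₁ (proj₂ fy))))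
packedOfUniqueFree R (inj₂ fc@(k∈ , c , _)) only =
  nonempty k∈ ,
  inj₁ ((λ y fy → notBoth (subst (λ z → isRow R z ≡ true) (only y (inj₁ fy)) (proj₁ (proj₂ fy))) c) ,
        (_ , fc , λ y fy → only y (inj₂ fy)))

proposition2p11 : (T : Tableau) (k : ℤ) → Free T k →
    Σ (List ℤ) λ A → Σ (Linked _<_ A) λ s →
      (∀ x → (x ∈ A) ⇔ Conn T k x) ×
      Packed (restrict T A s) × Free (restrict T A s) k
proposition2p11 T k fk = A , sortedA , inA , packedOfUniqueFree R fkR onlyK , fkR
  where
  A : List ℤ
  A = filter (connDec T fk) (labels T)

  sortedA : Linked _<_ A
  sortedA = Linked.filter⁺ (connDec T fk) ℤ.<-trans (sorted T)

  inA : ∀ x → (x ∈ A) ⇔ Conn T k x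
  inA x = mk⇔ (proj₂ ∘ ∈-filter⁻ (connDec T fk) {xs = labels T})
              (λ c → ∈-filter⁺ (connDec T fk) (connMem T (freeMem T fk) c) c)

  R : Tableau
  R = restrict T A sortedA

  fkR : Free R k
  fkR = restrictFree⁺ T A sortedA fk (from (inA k) base)

  onlyK : ∀ x → Free R x → x ≡ k
  onlyK x fx = freeUnique T fk
    (restrictFree⁻ T A sortedA (filter-⊆ (connDec T fk) (labels T)) (componentClosed T A inA) fx)
    (to (inA x) (freeMem R fx))
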